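{- Let $m,n,k\ge 2$. If $K(m,n)$ admits a $k$-super graceful labeling in which the $n$ greatest integers of $[k,k+m+n+mn-1]$ are the labels of the vertices of the partite set with $n$ vertices, then $k=n$.
   Context: For integers $a\le b$, $[a,b]$ is the set of integers between $a$ and $b$ inclusive. For $k\ge 1$, a $k$-super graceful labeling of a graph $G=(V,E)$ with $p$ vertices and $q$ edges is a bijection $f:V\cup E\to[k,k+p+q-1]$ with $f(uv)=|f(u)-f(v)|$ for every edge $uv$. $K(m,n)$ is the complete bipartite graph with partite sets of sizes $m$ and $n$ (so it has $m+n$ vertices and $mn$ edges). -}

module Defs where

open import Data.Nat using (ℕ; _+_; _*_; _∸_; _≤_; _<_)
open import Data.Fin using (Fin)
open import Data.Sum using (_⊎_; inj₁; inj₂)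
open import Data.Product using (_×_; _,_; Σ; ∃)
open import Relation.Binary.PropositionalEquality using (_≡_)

InInterval : ℕ → ℕ → ℕ → Set
InInterval a b x = a ≤ x × x ≤ b

absDiff : ℕ → ℕ → ℕ
absDiff x y = (x ∸ y) + (y ∸ x)

-- The complete bipartite graph K(m,n):
-- vertices: Fin m (partite set A, m vertices) ⊎ Fin n (partite set B, n vertices);
-- edges: one edge {inj₁ i , inj₂ j} for each pair (i , j) : Fin m × Fin n.
KVertex : ℕ → ℕ → Set
KVertex m n = Fin m ⊎ Fin n

KEdge : ℕ → ℕ → Set
KEdge m n = Fin m × Fin n

edgeA : ∀ {m n} → KEdge m n → KVertex m n
edgeA (i , j) = inj₁ i

edgeB : ∀ {m n} → KEdge m n → KVertex m n
edgeB (i , j) = inj₂ j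

KElem : ℕ → ℕ → Set
KElem m n = KVertex m n ⊎ KEdge m n

IsBijectionOnto : ∀ {m n} → ℕ → (KElem m n → ℕ) → Set
IsBijectionOnto {m} {n} k f =
  (∀ x y → f x ≡ f y → x ≡ y)
  × (∀ x → InInterval k (k + (m + n) + m * n ∸ 1) (f x))
  × (∀ ℓ → InInterval k (k + (m + n) + m * n ∸ 1) ℓ → ∃ λ x → f x ≡ ℓ)

IsKSuperGraceful : (m n k : ℕ) → (KElem m n → ℕ) → Set
IsKSuperGraceful m n k f =
  IsBijectionOnto {m} {n} k f
  × (∀ (e : KEdge m n) →
       f (inj₂ e) ≡ absDiff (f (inj₁ (edgeA e))) (f (inj₁ (edgeB e))))

-- The labels of the partite set with n vertices are exactly the n greatest
-- integers of [k, k+m+n+mn-1], i.e. the integers of [k+m+mn, k+m+n+mn-1].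
BSideTop : (m n k : ℕ) → (KElem m n → ℕ) → Set
BSideTop m n k f =
  (∀ (j : Fin n) → InInterval (k + m + m * n) (k + (m + n) + m * n ∸ 1) (f (inj₁ (inj₂ j))))
  × (∀ ℓ → InInterval (k + m + m * n) (k + (m + n) + m * n ∸ 1) ℓ →
       ∃ λ (j : Fin n) → f (inj₁ (inj₂ j)) ≡ ℓ)

module Submission where

-- Let c = k + m + mn and cut = c - 1.  The hypothesis says that the B-vertices
-- (the partite set of size n) carry exactly the labels cut+1, …, cut+n; by
-- injectivity every A-vertex label a_i and edge label e_ij then lies in
-- [k, cut], so each edge label is a plain difference: e_ij + a_i = b_j.
--   1. The B-vertex labelled cut+n gives cut+n = e_ij + a_i ≤ cut + a_i,
--      hence n ≤ a_i for every i.
--   2. The label cut is not on an A-vertex (the edge to the B-vertex labelled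
--      cut+1 would get label 1 < k), so it is an edge label, and its
--      A-endpoint has label ≤ n, hence exactly n.  In particular k ≤ n.
--   3. No edge label is n (n is an A-label), so n + a_i is never a B-label:
--      n + a_i ≤ cut for every i.
--   4. The label k is either an A-label (then n ≤ k by 1) or an edge label
--      e_ij, and then n + a_i ≤ cut < b_j = k + a_i (by 3), so n ≤ k.

open import Defs
open import Data.Nat using (ℕ; suc; _+_; _*_; _∸_; _≤_; _<_; s≤s; z≤n)
open import Data.Nat.Properties
open import Data.Fin using (Fin)
open import Data.Sum using (inj₁; inj₂)
open import Data.Product using (_×_; _,_; proj₁; proj₂; ∃)
open import Data.Empty using (⊥-elim)
open import Relation.Nullary using (¬_)
open import Relation.Binary.PropositionalEquality
open import Data.Nat.Solver using (module +-*-Solver)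
open +-*-Solver using (solve; _:+_; _:*_; _:=_)

absDiff-+ : ∀ {a b} → a ≤ b → absDiff a b + a ≡ b
absDiff-+ {a} {b} a≤b rewrite m≤n⇒m∸n≡0 a≤b = m∸n+n≡m a≤b

module TopLabelledB
  (m n k : ℕ) (1≤m : 1 ≤ m) (1≤n : 1 ≤ n) (f : KElem m n → ℕ)
  (graceful : IsKSuperGraceful m n k f) (bTop : BSideTop m n k f) where

  a : Fin m → ℕ
  a i = f (inj₁ (inj₁ i))

  b : Fin n → ℕ
  b j = f (inj₁ (inj₂ j))

  e : Fin m → Fin n → ℕ
  e i j = f (inj₂ (i , j))

  -- The largest label not used on a B-vertex.
  cut : ℕ
  cut = k + m + m * n ∸ 1

  k<c : k < k + m + m * n
  k<c = ≤-trans (m<m+n k 1≤m) (m≤m+n (k + m) (m * n))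

  1+cut≡c : suc cut ≡ k + m + m * n
  1+cut≡c = m+[n∸m]≡n (≤-trans (s≤s z≤n) k<c)

  k≤cut : k ≤ cut
  k≤cut = ≤-pred (subst (k <_) (sym 1+cut≡c) k<c)

  top≡cut+n : k + (m + n) + m * n ∸ 1 ≡ cut + n
  top≡cut+n = begin
    k + (m + n) + m * n ∸ 1 ≡⟨ cong (_∸ 1) (solve 3 (λ k m n →
                                 k :+ (m :+ n) :+ m :* n := k :+ m :+ m :* n :+ n)
                                 refl k m n) ⟩
    k + m + m * n + n ∸ 1   ≡⟨ +-∸-comm n (≤-trans (s≤s z≤n) k<c) ⟩
    cut + n                 ∎
    where open ≡-Reasoning

  injective : ∀ x y → f x ≡ f y → x ≡ y
  injective = proj₁ (proj₁ graceful)

  inRange : ∀ x → k ≤ f x × f x ≤ cut + n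
  inRange x with proj₁ (proj₂ (proj₁ graceful)) x
  ... | lo , hi = lo , subst (f x ≤_) top≡cut+n hi

  onto : ∀ ℓ → k ≤ ℓ → ℓ ≤ cut + n → ∃ λ x → f x ≡ ℓ
  onto ℓ lo hi = proj₂ (proj₂ (proj₁ graceful)) ℓ (lo , subst (ℓ ≤_) (sym top≡cut+n) hi)

  bRange : ∀ j → cut < b j
  bRange j = subst (_≤ b j) (sym 1+cut≡c) (proj₁ (proj₁ bTop j))

  bOnto : ∀ ℓ → cut < ℓ → ℓ ≤ cut + n → ∃ λ j → b j ≡ ℓ
  bOnto ℓ lo hi =
    proj₂ bTop ℓ (subst (_≤ ℓ) 1+cut≡c lo , subst (ℓ ≤_) (sym top≡cut+n) hi)

  high⇒B : ∀ x → cut < f x → ∃ λ j → inj₁ (inj₂ j) ≡ x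
  high⇒B x cut<fx with bOnto (f x) cut<fx (proj₂ (inRange x))
  ... | j , bj≡fx = j , injective _ _ bj≡fx

  aLow : ∀ i → a i ≤ cut
  aLow i = ≮⇒≥ notHigh
    where
      notHigh : ¬ cut < a i
      notHigh cut<ai with high⇒B _ cut<ai
      ... | _ , ()

  eLow : ∀ i j → e i j ≤ cut
  eLow i j = ≮⇒≥ notHigh
    where
      notHigh : ¬ cut < e i j
      notHigh cut<eij with high⇒B _ cut<eij
      ... | _ , ()

  -- Since a_i < b_j, every edge label is the difference b_j - a_i.
  edgeSum : ∀ i j → e i j + a i ≡ b j
  edgeSum i j = trans (cong (_+ a i) (proj₂ graceful (i , j)))
                      (absDiff-+ (≤-trans (aLow i) (<⇒≤ (bRange j))))

  -- Step 1: the B-vertex labelled cut + n forces every A-label to be ≥ n.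
  n≤a : ∀ i → n ≤ a i
  n≤a i with bOnto (cut + n) (m<m+n cut 1≤n) ≤-refl
  ... | j , bj≡top = +-cancelˡ-≤ cut n (a i) (begin
    cut + n      ≡⟨ sym bj≡top ⟩
    b j          ≡⟨ sym (edgeSum i j) ⟩
    e i j + a i  ≤⟨ +-monoˡ-≤ (a i) (eLow i j) ⟩
    cut + a i    ∎)
    where open ≤-Reasoning

  -- Step 2: the element labelled cut is an edge whose A-endpoint is labelled n.
  aLabelledN : 2 ≤ k → ∃ λ i → a i ≡ n
  aLabelledN 2≤k with onto cut k≤cut (m≤m+n cut n)
  ... | inj₁ (inj₁ i) , ai≡cut = ⊥-elim (k≰1 (subst (k ≤_) eij≡1 (proj₁ (inRange (inj₂ (i , j))))))
    where
      bLabelledCut+1 : ∃ λ j → b j ≡ suc cut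
      bLabelledCut+1 = bOnto (suc cut) ≤-refl (m<m+n cut 1≤n)
      j : Fin n
      j = proj₁ bLabelledCut+1
      eij≡1 : e i j ≡ 1
      eij≡1 = +-cancelʳ-≡ cut (e i j) 1 (begin
        e i j + cut   ≡⟨ cong (e i j +_) (sym ai≡cut) ⟩
        e i j + a i   ≡⟨ edgeSum i j ⟩
        b j           ≡⟨ proj₂ bLabelledCut+1 ⟩
        suc cut       ∎)
        where open ≡-Reasoning
      k≰1 : ¬ k ≤ 1
      k≰1 k≤1 with ≤-trans 2≤k k≤1
      ... | s≤s ()
  ... | inj₁ (inj₂ j) , bj≡cut = ⊥-elim (<-irrefl (sym bj≡cut) (bRange j))
  ... | inj₂ (i , j) , eij≡cut = i , ≤-antisym ai≤n (n≤a i)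
    where
      ai≤n : a i ≤ n
      ai≤n = +-cancelˡ-≤ cut (a i) n (begin
        cut + a i    ≡⟨ cong (_+ a i) (sym eij≡cut) ⟩
        e i j + a i  ≡⟨ edgeSum i j ⟩
        b j          ≤⟨ proj₂ (inRange (inj₁ (inj₂ j))) ⟩
        cut + n      ∎)
        where open ≤-Reasoning

  -- Step 3: n is an A-label, so no edge carries n and n + a_i is no B-label.
  n+a≤cut : 2 ≤ k → ∀ i → n + a i ≤ cut
  n+a≤cut 2≤k i = ≮⇒≥ notB
    where
      notB : ¬ cut < n + a i
      notB cut<n+ai with bOnto (n + a i) cut<n+ai
                              (subst (n + a i ≤_) (+-comm n cut) (+-monoʳ-≤ n (aLow i)))
                       | aLabelledN 2≤k
      ... | j , bj≡n+ai | i₀ , ai₀≡n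
        with injective (inj₂ (i , j)) (inj₁ (inj₁ i₀))
               (trans (+-cancelʳ-≡ (a i) (e i j) n (trans (edgeSum i j) bj≡n+ai)) (sym ai₀≡n))
      ... | ()

  -- Step 4: the element labelled k shows n ≤ k.
  n≤k : 2 ≤ k → n ≤ k
  n≤k 2≤k with onto k ≤-refl (≤-trans k≤cut (m≤m+n cut n))
  ... | inj₁ (inj₁ i) , ai≡k = subst (n ≤_) ai≡k (n≤a i)
  ... | inj₁ (inj₂ j) , bj≡k = ⊥-elim (<⇒≱ (bRange j) (subst (_≤ cut) (sym bj≡k) k≤cut))
  ... | inj₂ (i , j) , eij≡k = <⇒≤ (+-cancelʳ-< (a i) n k (begin-strict
    n + a i      ≤⟨ n+a≤cut 2≤k i ⟩
    cut          <⟨ bRange j ⟩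
    b j          ≡⟨ sym (edgeSum i j) ⟩
    e i j + a i  ≡⟨ cong (_+ a i) eij≡k ⟩
    k + a i      ∎))
    where open ≤-Reasoning

lemma4p6 : (m n k : ℕ) → 2 ≤ m → 2 ≤ n → 2 ≤ k →
    (f : KElem m n → ℕ) → IsKSuperGraceful m n k f → BSideTop m n k f →
    k ≡ n
lemma4p6 m n k 2≤m 2≤n 2≤k f graceful bTop = ≤-antisym k≤n (n≤k 2≤k)
  where
    open TopLabelledB m n k (<⇒≤ 2≤m) (<⇒≤ 2≤n) f graceful bTop
    k≤n : k ≤ n
    k≤n with aLabelledN 2≤k
    ... | i , ai≡n = subst (k ≤_) ai≡n (proj₁ (inRange (inj₁ (inj₁ i))))
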